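{- Let $(T;<)$ be a tree. Let $\mathcal{T}_{\mathrm{I}}$ be the set of type I trunks of $T$ that have no greatest node, and $\mathcal{T}_{\mathrm{fin}}$ the set of finitely generated trunks of $T$ that have no greatest node; for each trunk $\mathsf{S}$ let $t_{\mathsf{S}}$ be a new element not in $T$ (distinct for distinct $\mathsf{S}$). For $\mathcal{X}\in\{\mathcal{T}_{\mathrm{I}},\mathcal{T}_{\mathrm{fin}}\}$ define $T^{\mathcal{X}}:=T\cup\{t_{\mathsf{S}}:\mathsf{S}\in\mathcal{X}\}$ and the relation $<^{\mathcal{X}}$ on it consisting of: all $(x,y)\in T\times T$ with $x<y$; all $(t_{\mathsf{R}},t_{\mathsf{S}})$ with $\mathsf{R},\mathsf{S}\in\mathcal{X}$, $\mathsf{R}\subsetneq\mathsf{S}$; all $(u,t_{\mathsf{S}})$ with $\mathsf{S}\in\mathcal{X}$, $u\in\mathsf{S}$; all $(t_{\mathsf{S}},u)$ with $\mathsf{S}\in\mathcal{X}$ and $u\in T$ an upper bound of $\mathsf{S}$. Then (1) $(T^{\mathcal{T}_{\mathrm{I}}};<^{\mathcal{T}_{\mathrm{I}}})$ is an antichain complete tree containing $(T;<)$ as a substructure; (2) $(T^{\mathcal{T}_{\mathrm{fin}}};<^{\mathcal{T}_{\mathrm{fin}}})$ is a branching complete tree containing $(T;<)$ as a substructure.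
   Context: A tree is a set $T$ with a strict partial order $<$ such that for every $x\in T$ the set $\{y:y<x\}$ is linearly ordered, and any two nodes have a common lower bound (no well-foundedness or root assumed). A path is a maximal linearly ordered set of nodes. Stem: non-empty downward-closed chain bounded above. Bridge: non-empty convex chain $\mathsf{J}$ with, for each path $\mathsf{P}$, $\mathsf{J}\subseteq\mathsf{P}$ or $\mathsf{J}\cap\mathsf{P}=\emptyset$; $[t]$ is the maximal bridge containing $t$. Trunk: stem $\mathsf{A}$ with $\mathsf{A}=\bigcup_{t\in\mathsf{A}}[t]$. Type I trunk: trunk equal to $\bigcap_{i\in I}\mathsf{P}_i$ for a set of at least two paths. Finitely generated trunk: trunk equal to $\mathsf{P}\cap\mathsf{Q}$ for some paths. Antichain complete: every non-empty antichain (set of pairwise incomparable nodes) that is bounded below has an infimum. Branching complete: every pair of incomparable nodes has an infimum. -}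

module Defs where

open import Level using (Level; _⊔_; suc; Lift)
open import Data.Empty using (⊥)
open import Data.Product using (Σ; ∃; ∃₂; _×_; _,_)
open import Data.Sum using (_⊎_; inj₁; inj₂)
open import Relation.Unary using (Pred; _∈_; _∉_; _⊆_; _∩_)
open import Relation.Binary using (Rel; IsStrictPartialOrder)
open import Relation.Binary.PropositionalEquality using (_≡_)
open import Relation.Nullary using (¬_)

module TreeNotions {a ℓ r : Level} {X : Set a} (_≈_ : Rel X ℓ) (_<_ : Rel X r) where

  _≤_ : Rel X (ℓ ⊔ r)
  x ≤ y = x < y ⊎ x ≈ y

  Comparable : X → X → Set (ℓ ⊔ r)
  Comparable x y = x < y ⊎ x ≈ y ⊎ y < x

  IsTree : Set (a ⊔ ℓ ⊔ r)
  IsTree = IsStrictPartialOrder _≈_ _<_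
         × (∀ {x y z} → y < x → z < x → Comparable y z)
         × (∀ x y → ∃ λ z → z ≤ x × z ≤ y)

  Incomparable : X → X → Set (ℓ ⊔ r)
  Incomparable x y = ¬ (x ≤ y) × ¬ (y ≤ x)

  IsLowerBound : ∀ {p} → Pred X p → X → Set (a ⊔ p ⊔ ℓ ⊔ r)
  IsLowerBound A z = ∀ {x} → x ∈ A → z ≤ x

  IsInfimum : ∀ {p} → Pred X p → X → Set (a ⊔ p ⊔ ℓ ⊔ r)
  IsInfimum A z = IsLowerBound A z × (∀ w → IsLowerBound A w → w ≤ z)

  IsAntichain : ∀ {p} → Pred X p → Set (a ⊔ p ⊔ ℓ ⊔ r)
  IsAntichain A = ∀ {x y} → x ∈ A → y ∈ A → ¬ (x ≈ y) → Incomparable x y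

  AntichainComplete : (p : Level) → Set (a ⊔ suc p ⊔ ℓ ⊔ r)
  AntichainComplete p = (A : Pred X p) → IsAntichain A → (∃ λ x → x ∈ A)
    → (∃ λ z → IsLowerBound A z) → ∃ λ z → IsInfimum A z

  IsInfimum₂ : X → X → X → Set (a ⊔ ℓ ⊔ r)
  IsInfimum₂ x y z = z ≤ x × z ≤ y × (∀ w → w ≤ x → w ≤ y → w ≤ z)

  BranchingComplete : Set (a ⊔ ℓ ⊔ r)
  BranchingComplete = ∀ x y → Incomparable x y → ∃ λ z → IsInfimum₂ x y z

  IsChain : ∀ {p} → Pred X p → Set (a ⊔ p ⊔ ℓ ⊔ r)
  IsChain C = ∀ {x y} → x ∈ C → y ∈ C → Comparable x y

  IsPath : ∀ {p} → Pred X p → Set (a ⊔ suc p ⊔ ℓ ⊔ r)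
  IsPath {p} P = IsChain P × ((C : Pred X p) → IsChain C → P ⊆ C → C ⊆ P)

HausdorffMaximal : (ℓ : Level) → Set (suc ℓ)
HausdorffMaximal ℓ = (X : Set ℓ) (_<_ : Rel X ℓ) → IsStrictPartialOrder _≡_ _<_
  → (C : Pred X ℓ) → TreeNotions.IsChain _≡_ _<_ C
  → ∃ λ (P : Pred X ℓ) → TreeNotions.IsPath _≡_ _<_ P × C ⊆ P

module TrunkNotions {ℓ : Level} (T : Set ℓ) (_<_ : Rel T ℓ) where
  open TreeNotions {X = T} _≡_ _<_ public

  Subset : Set (suc ℓ)
  Subset = Pred T ℓ

  SameSet : ∀ {p q} → Pred T p → Pred T q → Set (ℓ ⊔ p ⊔ q)
  SameSet A B = A ⊆ B × B ⊆ A

  NonEmpty : Subset → Set ℓ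
  NonEmpty A = ∃ λ x → x ∈ A

  DownClosed : Subset → Set ℓ
  DownClosed A = ∀ {x y} → y < x → x ∈ A → y ∈ A

  IsUpperBound : Subset → T → Set ℓ
  IsUpperBound A u = ∀ {x} → x ∈ A → x ≤ u

  BoundedAbove : Subset → Set ℓ
  BoundedAbove A = ∃ λ u → IsUpperBound A u

  HasGreatest : Subset → Set ℓ
  HasGreatest A = ∃ λ x → x ∈ A × IsUpperBound A x

  IsStem : Subset → Set ℓ
  IsStem A = NonEmpty A × DownClosed A × IsChain A × BoundedAbove A

  Convex : Subset → Set ℓ
  Convex J = ∀ {x y z} → x ∈ J → z ∈ J → x < y → y < z → y ∈ J

  IsBridge : Subset → Set (suc ℓ)
  IsBridge J = NonEmpty J × IsChain J × Convex J
    × ((P : Subset) → IsPath P → J ⊆ P ⊎ (∀ {x} → x ∈ J → x ∉ P))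

  -- u ∈ [t]: [t] is the maximal bridge containing t, i.e. the union of all bridges containing t
  InBridgeOf : T → T → Set (suc ℓ)
  InBridgeOf t u = ∃ λ (J : Subset) → IsBridge J × t ∈ J × u ∈ J

  BridgeUnion : Subset → T → Set (suc ℓ)
  BridgeUnion A u = ∃ λ t → t ∈ A × InBridgeOf t u

  IsTrunk : Subset → Set (suc ℓ)
  IsTrunk A = IsStem A × (∀ {u} → u ∈ A → BridgeUnion A u) × (∀ {u} → BridgeUnion A u → u ∈ A)

  Intersection : Pred Subset ℓ → Pred T (suc ℓ)
  Intersection I x = (P : Subset) → P ∈ I → x ∈ P

  IsTypeITrunk : Subset → Set (suc ℓ)
  IsTypeITrunk S = IsTrunk S × ∃ λ (I : Pred Subset ℓ) →
      ((P : Subset) → P ∈ I → IsPath P)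
    × (∃₂ λ (P Q : Subset) → P ∈ I × Q ∈ I × ¬ SameSet P Q)
    × SameSet S (Intersection I)

  IsFinGenTrunk : Subset → Set (suc ℓ)
  IsFinGenTrunk S = IsTrunk S × ∃₂ λ (P Q : Subset) → IsPath P × IsPath Q × SameSet S (P ∩ Q)

  𝒯I : Subset → Set (suc ℓ)
  𝒯I S = IsTypeITrunk S × ¬ HasGreatest S

  𝒯fin : Subset → Set (suc ℓ)
  𝒯fin S = IsFinGenTrunk S × ¬ HasGreatest S

  -- The extension T^𝒳 = T ∪ {t_S : S ∈ 𝒳}.  New nodes are subsets S with a proof of S ∈ 𝒳;
  -- t_R and t_S are identified exactly when R and S are the same set (extensionally).
  module Extension (𝒳 : Subset → Set (suc ℓ)) where

    Node : Set (suc ℓ)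
    Node = T ⊎ Σ Subset 𝒳

    _≈ˣ_ : Rel Node (suc ℓ)
    inj₁ x ≈ˣ inj₁ y = Lift (suc ℓ) (x ≡ y)
    inj₁ x ≈ˣ inj₂ S = Lift (suc ℓ) ⊥
    inj₂ R ≈ˣ inj₁ y = Lift (suc ℓ) ⊥
    inj₂ (R , _) ≈ˣ inj₂ (S , _) = Lift (suc ℓ) (SameSet R S)

    _<ˣ_ : Rel Node (suc ℓ)
    inj₁ x <ˣ inj₁ y = Lift (suc ℓ) (x < y)
    inj₂ (R , _) <ˣ inj₂ (S , _) = Lift (suc ℓ) (R ⊆ S × ¬ (S ⊆ R))
    inj₁ u <ˣ inj₂ (S , _) = Lift (suc ℓ) (u ∈ S)
    inj₂ (S , _) <ˣ inj₁ u = Lift (suc ℓ) (IsUpperBound S u)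

    ContainsT : Set (suc ℓ)
    ContainsT = (∀ x y → inj₁ x ≈ˣ inj₁ y → x ≡ y)
              × (∀ x y → x < y → inj₁ x <ˣ inj₁ y)
              × (∀ x y → inj₁ x <ˣ inj₁ y → x < y)

-- A node n of T^𝒳 is determined by the stem ⇓ n of old nodes below it (↓ x for x ∈ T, S for t_S),
-- and n <^𝒳 m holds exactly when ⇓ n ⊊ ⇓ m; so T^𝒳 is a family of stems of T under strict
-- inclusion, and the tree axioms reduce to the fact that two down-closed subsets of a chain are
-- ⊆-comparable. The infimum of a family A of nodes is the node representing L = ⋂_{n ∈ A} ⇓ n:
-- its greatest element if it has one, otherwise t_L. That t_L exists comes from one observation:
-- if n, m are incomparable and P ⊇ ⇓ n, Q ⊇ ⇓ m are paths, then P ∩ Q ⊆ ⇓ n. So when every member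
-- of A has an incomparable partner in A, L is the intersection of the paths through the sets ⇓ n
-- (two of them when A = {n, m}), and an intersection of paths cannot be left by a bridge, so it is a
-- trunk.
module Submission where

open import Defs
open import Level using (Level; suc)
open import Data.Product using (_×_)
open import Relation.Binary using (Rel)
open import Relation.Binary.PropositionalEquality using (_≡_)
open import Axiom.ExcludedMiddle using (ExcludedMiddle)

open import Level using (Lift; lift; lower)
open import Data.Empty using (⊥; ⊥-elim)
open import Data.Product using (∃; _,_; proj₁; proj₂; swap)
open import Data.Sum using (_⊎_; inj₁; inj₂; [_,_]′)
open import Function using (id; _∘_)
open import Relation.Binary using (IsStrictPartialOrder)
open import Relation.Binary.PropositionalEquality using (refl)
open import Relation.Nullary using (¬_; yes; no)
open import Relation.Nullary.Decidable using (True; toWitness; fromWitness)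
open import Relation.Unary using (Pred; _∈_; _⊆_; _⊂_; _≐_; _∩_; _∪_; ｛_｝)
open import Relation.Unary.Properties using (⊂⇒⊆; ⊂-trans; ⊂-irrefl; ⊂-respʳ-≐; ⊂-respˡ-≐; ≐-refl; ≐-sym; ≐-trans)

-- Excluded middle one level up turns every proposition into a lifted boolean test, so the
-- intersection of a large family of subsets of T is again a subset of T.
module Resizing {ℓ : Level} (em : ExcludedMiddle (suc ℓ)) where

  Resize : Set (suc ℓ) → Set ℓ
  Resize P = Lift ℓ (True (em {P}))

  resize : ∀ {P} → P → Resize P
  resize p = lift (fromWitness p)

  unresize : ∀ {P} → Resize P → P
  unresize r = toWitness (lower r)

module TreeLemmas {ℓ : Level} {T : Set ℓ} {_<_ : Rel T ℓ} (tree : TreeNotions.IsTree {X = T} _≡_ _<_) where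
  open TrunkNotions T _<_

  <-isStrictPartialOrder : IsStrictPartialOrder _≡_ _<_
  <-isStrictPartialOrder = proj₁ tree

  predecessors-comparable : ∀ {x y z} → y < x → z < x → Comparable y z
  predecessors-comparable = proj₁ (proj₂ tree)

  common-lower-bound : ∀ x y → ∃ λ z → z ≤ x × z ≤ y
  common-lower-bound = proj₂ (proj₂ tree)

  <-irrefl : ∀ {x} → ¬ (x < x)
  <-irrefl = IsStrictPartialOrder.irrefl <-isStrictPartialOrder refl

  <-trans : ∀ {x y z} → x < y → y < z → x < z
  <-trans = IsStrictPartialOrder.trans <-isStrictPartialOrder

  <⇒≱ : ∀ {x y} → x < y → ¬ (y ≤ x)
  <⇒≱ x<y (inj₁ y<x) = <-irrefl (<-trans x<y y<x)
  <⇒≱ x<y (inj₂ refl) = <-irrefl x<y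

  ≤-trans : ∀ {x y z} → x ≤ y → y ≤ z → x ≤ z
  ≤-trans (inj₁ x<y) (inj₁ y<z) = inj₁ (<-trans x<y y<z)
  ≤-trans (inj₁ x<y) (inj₂ refl) = inj₁ x<y
  ≤-trans (inj₂ refl) y≤z = y≤z

  downClosed-≤ : ∀ {A} → DownClosed A → ∀ {x y} → y ≤ x → x ∈ A → y ∈ A
  downClosed-≤ dc (inj₁ y<x) x∈A = dc y<x x∈A
  downClosed-≤ dc (inj₂ refl) x∈A = x∈A

  stem-nonEmpty : ∀ {A} → IsStem A → NonEmpty A
  stem-nonEmpty = proj₁

  stem-downClosed : ∀ {A} → IsStem A → DownClosed A
  stem-downClosed = proj₁ ∘ proj₂

  stem-chain : ∀ {A} → IsStem A → IsChain A
  stem-chain = proj₁ ∘ proj₂ ∘ proj₂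

  stem-boundedAbove : ∀ {A} → IsStem A → BoundedAbove A
  stem-boundedAbove = proj₂ ∘ proj₂ ∘ proj₂

  ↓ : T → Subset
  ↓ x z = z ≤ x

  ↓-stem : ∀ x → IsStem (↓ x)
  ↓-stem x = (x , inj₂ refl) , downClosed , chain , x , id
    where
    downClosed : DownClosed (↓ x)
    downClosed y<z z≤x = ≤-trans (inj₁ y<z) z≤x
    chain : IsChain (↓ x)
    chain (inj₁ y<x) (inj₁ z<x) = predecessors-comparable y<x z<x
    chain (inj₁ y<x) (inj₂ refl) = inj₁ y<x
    chain (inj₂ refl) (inj₁ z<x) = inj₂ (inj₂ z<x)
    chain (inj₂ refl) (inj₂ refl) = inj₂ (inj₁ refl)

  ↓-chain : ∀ x → IsChain (↓ x)
  ↓-chain = stem-chain ∘ ↓-stem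

  module _ (em : ExcludedMiddle ℓ) where

    chain-downClosed-⊆-total : ∀ {C A B : Subset} → IsChain C → DownClosed A → DownClosed B
      → A ⊆ C → B ⊆ C → A ⊆ B ⊎ B ⊆ A
    chain-downClosed-⊆-total {C} {A} {B} chain dcA dcB A⊆C B⊆C with em {∃ λ a → a ∈ A × ¬ (a ∈ B)}
    ... | yes (a , a∈A , a∉B) = inj₂ B⊆A
      where
      B⊆A : B ⊆ A
      B⊆A b∈B with chain (A⊆C a∈A) (B⊆C b∈B)
      ... | inj₁ a<b = ⊥-elim (a∉B (dcB a<b b∈B))
      ... | inj₂ (inj₁ refl) = ⊥-elim (a∉B b∈B)
      ... | inj₂ (inj₂ b<a) = dcA b<a a∈A
    ... | no A⊈B = inj₁ A⊆B
      where
      A⊆B : A ⊆ B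
      A⊆B {x} x∈A with em {x ∈ B}
      ... | yes x∈B = x∈B
      ... | no x∉B = ⊥-elim (A⊈B (x , x∈A , x∉B))

    ∈⊎upperBound : ∀ {C D : Subset} {w} → IsChain C → DownClosed D → D ⊆ C → w ∈ C → w ∈ D ⊎ IsUpperBound D w
    ∈⊎upperBound {C} {D} {w} chain dc D⊆C w∈C with em {w ∈ D}
    ... | yes w∈D = inj₁ w∈D
    ... | no w∉D = inj₂ bound
      where
      bound : IsUpperBound D w
      bound x∈D with chain (D⊆C x∈D) w∈C
      ... | inj₁ x<w = inj₁ x<w
      ... | inj₂ (inj₁ refl) = ⊥-elim (w∉D x∈D)
      ... | inj₂ (inj₂ w<x) = ⊥-elim (w∉D (dc w<x x∈D))

    singleton-bridge : ∀ u → IsBridge ｛ u ｝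
    singleton-bridge u = (u , refl) , chain , convex , inside⊎disjoint
      where
      chain : IsChain ｛ u ｝
      chain refl refl = inj₂ (inj₁ refl)
      convex : Convex ｛ u ｝
      convex refl refl x<y y<x = ⊥-elim (<-irrefl (<-trans x<y y<x))
      inside⊎disjoint : (P : Subset) → IsPath P → ｛ u ｝ ⊆ P ⊎ (∀ {x} → x ∈ ｛ u ｝ → ¬ (x ∈ P))
      inside⊎disjoint P _ with em {u ∈ P}
      ... | yes u∈P = inj₁ λ { refl → u∈P }
      ... | no u∉P = inj₂ λ { refl → u∉P }

    stem-⋂-of-paths⇒trunk : ∀ {L} → IsStem L
      → (∀ {u} → (∀ P → IsPath P → L ⊆ P → u ∈ P) → u ∈ L) → IsTrunk L
    stem-⋂-of-paths⇒trunk {L} stem closed = stem , (λ {u} u∈L → u , u∈L , ｛ u ｝ , singleton-bridge u , refl , refl) , bridge⊆L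
      where
      bridge⊆L : ∀ {u} → BridgeUnion L u → u ∈ L
      bridge⊆L (t , t∈L , J , (_ , _ , _ , inside⊎disjoint) , t∈J , u∈J) = closed λ P isPath L⊆P →
        [ (λ J⊆P → J⊆P u∈J) , (λ disjoint → ⊥-elim (disjoint t∈J (L⊆P t∈L))) ]′ (inside⊎disjoint P isPath)

module ExtensionLemmas {ℓ : Level} (em : ExcludedMiddle ℓ) (hm : HausdorffMaximal ℓ)
  (T : Set ℓ) (_<_ : Rel T ℓ) (tree : TreeNotions.IsTree {X = T} _≡_ _<_)
  (𝒳 : Pred (Pred T ℓ) (suc ℓ))
  (𝒳⇒stem : ∀ {S} → 𝒳 S → TrunkNotions.IsStem T _<_ S)
  (𝒳⇒¬greatest : ∀ {S} → 𝒳 S → ¬ TrunkNotions.HasGreatest T _<_ S) where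

  open TrunkNotions T _<_
  open TreeLemmas tree
  open Extension 𝒳 public
  module X = TreeNotions _≈ˣ_ _<ˣ_

  ⇓ : Node → Subset
  ⇓ (inj₁ x) = ↓ x
  ⇓ (inj₂ (S , _)) = S

  ⇓-stem : ∀ n → IsStem (⇓ n)
  ⇓-stem (inj₁ x) = ↓-stem x
  ⇓-stem (inj₂ (_ , S∈𝒳)) = 𝒳⇒stem S∈𝒳

  ⇓-downClosed : ∀ n → DownClosed (⇓ n)
  ⇓-downClosed = stem-downClosed ∘ ⇓-stem

  ⇓-chain : ∀ n → IsChain (⇓ n)
  ⇓-chain = stem-chain ∘ ⇓-stem

  <ˣ⇒⊂ : ∀ {n m} → n <ˣ m → ⇓ n ⊂ ⇓ m
  <ˣ⇒⊂ {inj₁ x} {inj₁ y} (lift x<y) = (λ z≤x → ≤-trans z≤x (inj₁ x<y)) , λ ↓y⊆↓x → <⇒≱ x<y (↓y⊆↓x (inj₂ refl))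
  <ˣ⇒⊂ {inj₁ u} {inj₂ (S , S∈𝒳)} (lift u∈S) = (λ z≤u → downClosed-≤ (stem-downClosed (𝒳⇒stem S∈𝒳)) z≤u u∈S)
                                             , λ S⊆↓u → 𝒳⇒¬greatest S∈𝒳 (u , u∈S , S⊆↓u)
  <ˣ⇒⊂ {inj₂ (S , S∈𝒳)} {inj₁ u} (lift S≤u) = S≤u , λ ↓u⊆S → 𝒳⇒¬greatest S∈𝒳 (u , ↓u⊆S (inj₂ refl) , S≤u)
  <ˣ⇒⊂ {inj₂ _} {inj₂ _} (lift R⊂S) = R⊂S

  ⊂⇒<ˣ : ∀ {n m} → ⇓ n ⊂ ⇓ m → n <ˣ m
  ⊂⇒<ˣ {inj₁ x} {inj₁ y} (↓x⊆↓y , ↓y⊈↓x) with ↓x⊆↓y (inj₂ refl)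
  ... | inj₁ x<y = lift x<y
  ... | inj₂ refl = ⊥-elim (↓y⊈↓x id)
  ⊂⇒<ˣ {inj₁ _} {inj₂ _} (↓u⊆S , _) = lift (↓u⊆S (inj₂ refl))
  ⊂⇒<ˣ {inj₂ _} {inj₁ _} (S⊆↓u , _) = lift S⊆↓u
  ⊂⇒<ˣ {inj₂ _} {inj₂ _} R⊂S = lift R⊂S

  ≈ˣ⇒≐ : ∀ {n m} → n ≈ˣ m → ⇓ n ≐ ⇓ m
  ≈ˣ⇒≐ {inj₁ _} {inj₁ _} (lift refl) = ≐-refl
  ≈ˣ⇒≐ {inj₂ _} {inj₂ _} (lift R≐S) = R≐S

  ≐⇒≈ˣ : ∀ {n m} → ⇓ n ≐ ⇓ m → n ≈ˣ m
  ≐⇒≈ˣ {inj₁ x} {inj₁ y} (↓x⊆↓y , ↓y⊆↓x) with ↓x⊆↓y (inj₂ refl)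
  ... | inj₁ x<y = ⊥-elim (<⇒≱ x<y (↓y⊆↓x (inj₂ refl)))
  ... | inj₂ x≡y = lift x≡y
  ≐⇒≈ˣ {inj₁ x} {inj₂ (_ , S∈𝒳)} (↓x⊆S , S⊆↓x) = ⊥-elim (𝒳⇒¬greatest S∈𝒳 (x , ↓x⊆S (inj₂ refl) , S⊆↓x))
  ≐⇒≈ˣ {inj₂ (_ , S∈𝒳)} {inj₁ x} (S⊆↓x , ↓x⊆S) = ⊥-elim (𝒳⇒¬greatest S∈𝒳 (x , ↓x⊆S (inj₂ refl) , S⊆↓x))
  ≐⇒≈ˣ {inj₂ _} {inj₂ _} R≐S = lift R≐S

  <ˣ-isStrictPartialOrder : IsStrictPartialOrder _≈ˣ_ _<ˣ_
  <ˣ-isStrictPartialOrder = record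
    { isEquivalence = record
        { refl = ≐⇒≈ˣ ≐-refl
        ; sym = ≐⇒≈ˣ ∘ ≐-sym ∘ ≈ˣ⇒≐
        ; trans = λ n≈m m≈k → ≐⇒≈ˣ (≐-trans (≈ˣ⇒≐ n≈m) (≈ˣ⇒≐ m≈k))
        }
    ; irrefl = λ n≈m n<m → ⊂-irrefl (≈ˣ⇒≐ n≈m) (<ˣ⇒⊂ n<m)
    ; trans = λ n<m m<k → ⊂⇒<ˣ (⊂-trans (<ˣ⇒⊂ n<m) (<ˣ⇒⊂ m<k))
    ; <-resp-≈ = (λ m≈k n<m → ⊂⇒<ˣ (⊂-respʳ-≐ (≈ˣ⇒≐ m≈k) (<ˣ⇒⊂ n<m)))
               , (λ n≈k n<m → ⊂⇒<ˣ (⊂-respˡ-≐ (≈ˣ⇒≐ n≈k) (<ˣ⇒⊂ n<m)))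
    }

  ≈ˣ-sym : ∀ {n m} → n ≈ˣ m → m ≈ˣ n
  ≈ˣ-sym = IsStrictPartialOrder.Eq.sym <ˣ-isStrictPartialOrder

  ≈ˣ-trans : ∀ {n m k} → n ≈ˣ m → m ≈ˣ k → n ≈ˣ k
  ≈ˣ-trans = IsStrictPartialOrder.Eq.trans <ˣ-isStrictPartialOrder

  ⊆⇒≤ˣ : ∀ {n m} → ⇓ n ⊆ ⇓ m → n X.≤ m
  ⊆⇒≤ˣ {n} {m} n⊆m with em {⇓ m ⊆ ⇓ n}
  ... | yes m⊆n = inj₂ (≐⇒≈ˣ (n⊆m , m⊆n))
  ... | no m⊈n = inj₁ (⊂⇒<ˣ (n⊆m , m⊈n))

  ≤ˣ⇒⊆ : ∀ {n m} → n X.≤ m → ⇓ n ⊆ ⇓ m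
  ≤ˣ⇒⊆ (inj₁ n<m) = ⊂⇒⊆ (<ˣ⇒⊂ n<m)
  ≤ˣ⇒⊆ (inj₂ n≈m) = proj₁ (≈ˣ⇒≐ n≈m)

  ≤ˣ⇒comparable : ∀ {n m} → n X.≤ m → X.Comparable n m
  ≤ˣ⇒comparable (inj₁ n<m) = inj₁ n<m
  ≤ˣ⇒comparable (inj₂ n≈m) = inj₂ (inj₁ n≈m)

  ≥ˣ⇒comparable : ∀ {n m} → m X.≤ n → X.Comparable n m
  ≥ˣ⇒comparable (inj₁ m<n) = inj₂ (inj₂ m<n)
  ≥ˣ⇒comparable (inj₂ m≈n) = inj₂ (inj₁ (≈ˣ-sym m≈n))

  ⇓-in-chain⇒comparable : ∀ {C n m} → IsChain C → ⇓ n ⊆ C → ⇓ m ⊆ C → X.Comparable n m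
  ⇓-in-chain⇒comparable {n = n} {m} chain n⊆C m⊆C =
    [ ≤ˣ⇒comparable ∘ ⊆⇒≤ˣ , ≥ˣ⇒comparable ∘ ⊆⇒≤ˣ ]′
      (chain-downClosed-⊆-total em chain (⇓-downClosed n) (⇓-downClosed m) n⊆C m⊆C)

  common-lower-boundˣ : ∀ n m → ∃ λ k → k X.≤ n × k X.≤ m
  common-lower-boundˣ n m with stem-nonEmpty (⇓-stem n) | stem-nonEmpty (⇓-stem m)
  ... | x , x∈n | y , y∈m with common-lower-bound x y
  ... | z , z≤x , z≤y = inj₁ z , ⊆⇒≤ˣ (λ v≤z → downClosed-≤ (⇓-downClosed n) (≤-trans v≤z z≤x) x∈n)
                               , ⊆⇒≤ˣ (λ v≤z → downClosed-≤ (⇓-downClosed m) (≤-trans v≤z z≤y) y∈m)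

  <ˣ-isTree : X.IsTree
  <ˣ-isTree = <ˣ-isStrictPartialOrder , predecessors-comparableˣ , common-lower-boundˣ
    where
    predecessors-comparableˣ : ∀ {n m k} → m <ˣ n → k <ˣ n → X.Comparable m k
    predecessors-comparableˣ {n} m<n k<n = ⇓-in-chain⇒comparable (⇓-chain n) (⊂⇒⊆ (<ˣ⇒⊂ m<n)) (⊂⇒⊆ (<ˣ⇒⊂ k<n))

  containsT : ContainsT
  containsT = (λ _ _ → lower) , (λ _ _ → lift) , (λ _ _ → lower)

  incomparable⇒¬⇓-in-chain : ∀ {C n m} → X.Incomparable n m → IsChain C → ⇓ n ⊆ C → ⇓ m ⊆ C → ⊥
  incomparable⇒¬⇓-in-chain (n≰m , m≰n) chain n⊆C m⊆C with ⇓-in-chain⇒comparable chain n⊆C m⊆C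
  ... | inj₁ n<m = n≰m (inj₁ n<m)
  ... | inj₂ (inj₁ n≈m) = n≰m (inj₂ n≈m)
  ... | inj₂ (inj₂ m<n) = m≰n (inj₁ m<n)

  incomparable⇒chains-∩-⊆ : ∀ {P Q n m} → X.Incomparable n m → IsChain P → ⇓ n ⊆ P
    → IsChain Q → ⇓ m ⊆ Q → P ∩ Q ⊆ ⇓ n
  incomparable⇒chains-∩-⊆ {n = n} {m} inc chainP n⊆P chainQ m⊆Q (w∈P , w∈Q)
    with ∈⊎upperBound em chainP (⇓-downClosed n) n⊆P w∈P | ∈⊎upperBound em chainQ (⇓-downClosed m) m⊆Q w∈Q
  ... | inj₁ w∈n | _ = w∈n
  ... | inj₂ n≤w | inj₁ w∈m = ⊥-elim (proj₁ inc (⊆⇒≤ˣ λ x∈n → downClosed-≤ (⇓-downClosed m) (n≤w x∈n) w∈m))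
  ... | inj₂ n≤w | inj₂ m≤w = ⊥-elim (incomparable⇒¬⇓-in-chain inc (↓-chain _) n≤w m≤w)

  path-through : ∀ n → ∃ λ P → IsPath P × ⇓ n ⊆ P
  path-through n = hm T _<_ <-isStrictPartialOrder (⇓ n) (⇓-chain n)

  incomparable⇒chains-∩-≐ : ∀ {P Q n m} → X.Incomparable n m → IsChain P → ⇓ n ⊆ P
    → IsChain Q → ⇓ m ⊆ Q → P ∩ Q ≐ ⇓ n ∩ ⇓ m
  incomparable⇒chains-∩-≐ inc chainP n⊆P chainQ m⊆Q =
      (λ (x∈P , x∈Q) → incomparable⇒chains-∩-⊆ inc chainP n⊆P chainQ m⊆Q (x∈P , x∈Q)
                     , incomparable⇒chains-∩-⊆ (swap inc) chainQ m⊆Q chainP n⊆P (x∈Q , x∈P))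
    , λ (x∈n , x∈m) → n⊆P x∈n , m⊆Q x∈m

  node-of-stem : ∀ {L} → IsStem L → (¬ HasGreatest L → 𝒳 L) → ∃ λ w → ⇓ w ≐ L
  node-of-stem {L} stem new with em {HasGreatest L}
  ... | yes (g , g∈L , L≤g) = inj₁ g , (λ x≤g → downClosed-≤ (stem-downClosed stem) x≤g g∈L) , L≤g
  ... | no ¬greatest = inj₂ (L , new ¬greatest) , ≐-refl

  ⋂⇓ : Pred Node (suc ℓ) → Pred T (suc ℓ)
  ⋂⇓ A x = ∀ {n} → n ∈ A → x ∈ ⇓ n

  module Meet {A : Pred Node (suc ℓ)} {L : Subset} (L≐⋂⇓A : L ≐ ⋂⇓ A) where

    meet-stem : ∀ {a z} → a ∈ A → X.IsLowerBound A z → IsStem L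
    meet-stem {a} {z} a∈A z-lb = nonEmpty , downClosed , chain , bound , bound-≥
      where
      nonEmpty : NonEmpty L
      nonEmpty with stem-nonEmpty (⇓-stem z)
      ... | x , x∈z = x , proj₂ L≐⋂⇓A (λ n∈A → ≤ˣ⇒⊆ (z-lb n∈A) x∈z)
      downClosed : DownClosed L
      downClosed y<x x∈L = proj₂ L≐⋂⇓A λ {n} n∈A → ⇓-downClosed n y<x (proj₁ L≐⋂⇓A x∈L n∈A)
      chain : IsChain L
      chain x∈L y∈L = ⇓-chain a (proj₁ L≐⋂⇓A x∈L a∈A) (proj₁ L≐⋂⇓A y∈L a∈A)
      bound : T
      bound = proj₁ (stem-boundedAbove (⇓-stem a))
      bound-≥ : IsUpperBound L bound
      bound-≥ x∈L = proj₂ (stem-boundedAbove (⇓-stem a)) (proj₁ L≐⋂⇓A x∈L a∈A)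

    meet-infimum : ∀ {w} → ⇓ w ≐ L → X.IsInfimum A w
    meet-infimum w≐L = (λ n∈A → ⊆⇒≤ˣ λ x∈w → proj₁ L≐⋂⇓A (proj₁ w≐L x∈w) n∈A)
                     , (λ v v-lb → ⊆⇒≤ˣ λ x∈v → proj₂ w≐L (proj₂ L≐⋂⇓A λ n∈A → ≤ˣ⇒⊆ (v-lb n∈A) x∈v))

    module _ (partner : ∀ {n} → n ∈ A → ∃ λ m → m ∈ A × X.Incomparable n m) where

      ⋂-paths-through-A⊆L : ∀ {x} → (∀ {P} → IsPath P → ∀ {n} → n ∈ A → ⇓ n ⊆ P → x ∈ P) → x ∈ L
      ⋂-paths-through-A⊆L {x} on-paths = proj₂ L≐⋂⇓A ∈⇓
        where
        ∈⇓ : ∀ {n} → n ∈ A → x ∈ ⇓ n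
        ∈⇓ {n} n∈A with partner n∈A | path-through n
        ... | m , m∈A , inc | P , isPathP , n⊆P with path-through m
        ... | Q , isPathQ , m⊆Q = incomparable⇒chains-∩-⊆ inc (proj₁ isPathP) n⊆P (proj₁ isPathQ) m⊆Q
                                    (on-paths isPathP n∈A n⊆P , on-paths isPathQ m∈A m⊆Q)

      meet-trunk : IsStem L → IsTrunk L
      meet-trunk stem = stem-⋂-of-paths⇒trunk em stem λ on-paths →
        ⋂-paths-through-A⊆L λ isPath n∈A n⊆P → on-paths _ isPath λ x∈L → n⊆P (proj₁ L≐⋂⇓A x∈L n∈A)

  ∩≐⋂⇓-pair : ∀ {n m} → ⇓ n ∩ ⇓ m ≐ ⋂⇓ (｛ n ｝ ∪ ｛ m ｝)
  ∩≐⋂⇓-pair = (λ { (x∈n , _) (inj₁ refl) → x∈n ; (_ , x∈m) (inj₂ refl) → x∈m })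
           , λ x∈all → x∈all (inj₁ refl) , x∈all (inj₂ refl)

  pair-lowerBound : ∀ {n m z} → z X.≤ n → z X.≤ m → X.IsLowerBound (｛ n ｝ ∪ ｛ m ｝) z
  pair-lowerBound z≤n _ (inj₁ refl) = z≤n
  pair-lowerBound _ z≤m (inj₂ refl) = z≤m

  pair-incomparable-partner : ∀ {n m} → X.Incomparable n m → ∀ {k} → k ∈ ｛ n ｝ ∪ ｛ m ｝
    → ∃ λ l → l ∈ ｛ n ｝ ∪ ｛ m ｝ × X.Incomparable k l
  pair-incomparable-partner {m = m} inc (inj₁ refl) = m , inj₂ refl , inc
  pair-incomparable-partner {n = n} inc (inj₂ refl) = n , inj₁ refl , swap inc

  pair-infimum⇒infimum₂ : ∀ {n m w} → X.IsInfimum (｛ n ｝ ∪ ｛ m ｝) w → X.IsInfimum₂ n m w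
  pair-infimum⇒infimum₂ (w-lb , w-greatest) =
    w-lb (inj₁ refl) , w-lb (inj₂ refl) , λ v v≤n v≤m → w-greatest v (pair-lowerBound v≤n v≤m)

module FinitelyGenerated {ℓ : Level} (em : ExcludedMiddle ℓ) (hm : HausdorffMaximal ℓ)
  (T : Set ℓ) (_<_ : Rel T ℓ) (tree : TreeNotions.IsTree {X = T} _≡_ _<_) where

  open TrunkNotions T _<_
  open ExtensionLemmas em hm T _<_ tree 𝒯fin (proj₁ ∘ proj₁ ∘ proj₁) proj₂ public

  module _ {n m : Node} (inc : X.Incomparable n m) where
    open Meet (∩≐⋂⇓-pair {n} {m})

    ∩-stem : IsStem (⇓ n ∩ ⇓ m)
    ∩-stem with common-lower-boundˣ n m
    ... | z , z≤n , z≤m = meet-stem (inj₁ refl) (pair-lowerBound z≤n z≤m)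

    ∩-finGen : ¬ HasGreatest (⇓ n ∩ ⇓ m) → 𝒯fin (⇓ n ∩ ⇓ m)
    ∩-finGen ¬greatest with path-through n | path-through m
    ... | P , isPathP , n⊆P | Q , isPathQ , m⊆Q =
      ( meet-trunk (pair-incomparable-partner inc) ∩-stem , P , Q , isPathP , isPathQ
      , ≐-sym (incomparable⇒chains-∩-≐ inc (proj₁ isPathP) n⊆P (proj₁ isPathQ) m⊆Q)) , ¬greatest

    ∩-infimum₂ : ∃ λ w → X.IsInfimum₂ n m w
    ∩-infimum₂ with node-of-stem ∩-stem ∩-finGen
    ... | w , w≐∩ = w , pair-infimum⇒infimum₂ (meet-infimum w≐∩)

  branchingComplete : X.BranchingComplete
  branchingComplete _ _ = ∩-infimum₂

module TypeI {ℓ : Level} (em : ExcludedMiddle ℓ) (em₁ : ExcludedMiddle (suc ℓ)) (hm : HausdorffMaximal ℓ)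
  (T : Set ℓ) (_<_ : Rel T ℓ) (tree : TreeNotions.IsTree {X = T} _≡_ _<_) where

  open TrunkNotions T _<_
  open ExtensionLemmas em hm T _<_ tree 𝒯I (proj₁ ∘ proj₁ ∘ proj₁) proj₂ public
  open Resizing em₁

  ⋂⇓-resized : Pred Node (suc ℓ) → Subset
  ⋂⇓-resized A x = Resize (⋂⇓ A x)

  ⋂⇓-resized≐⋂⇓ : ∀ A → ⋂⇓-resized A ≐ ⋂⇓ A
  ⋂⇓-resized≐⋂⇓ A = unresize , resize

  PathsThrough : Pred Node (suc ℓ) → Pred Subset ℓ
  PathsThrough A P = Resize (IsPath P × ∃ λ n → n ∈ A × ⇓ n ⊆ P)

  path∈PathsThrough : ∀ {A P n} → IsPath P → n ∈ A → ⇓ n ⊆ P → P ∈ PathsThrough A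
  path∈PathsThrough {A} {P} {n} isPath n∈A n⊆P = resize {IsPath P × ∃ λ k → k ∈ A × ⇓ k ⊆ P} (isPath , n , n∈A , n⊆P)

  module _ {A : Pred Node (suc ℓ)} (antichain : X.IsAntichain A) {a b z : Node}
    (a∈A : a ∈ A) (b∈A : b ∈ A) (b≉a : ¬ (b ≈ˣ a)) (z-lb : X.IsLowerBound A z) where
    open Meet (⋂⇓-resized≐⋂⇓ A)

    partner : ∀ {n} → n ∈ A → ∃ λ m → m ∈ A × X.Incomparable n m
    partner {n} n∈A with em₁ {n ≈ˣ a}
    ... | yes n≈a = b , b∈A , antichain n∈A b∈A λ n≈b → b≉a (≈ˣ-trans (≈ˣ-sym n≈b) n≈a)
    ... | no n≉a = a , a∈A , antichain n∈A a∈A n≉a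

    ⋂⇓-stem : IsStem (⋂⇓-resized A)
    ⋂⇓-stem = meet-stem a∈A z-lb

    ⋂⇓≐⋂paths : SameSet (⋂⇓-resized A) (Intersection (PathsThrough A))
    ⋂⇓≐⋂paths = (λ x∈L P P∈ → let (_ , n , n∈A , n⊆P) = unresize P∈ in n⊆P (unresize x∈L n∈A))
              , λ x∈⋂ → ⋂-paths-through-A⊆L partner λ isPath n∈A n⊆P → x∈⋂ _ (path∈PathsThrough isPath n∈A n⊆P)

    ⋂⇓-typeI : ¬ HasGreatest (⋂⇓-resized A) → 𝒯I (⋂⇓-resized A)
    ⋂⇓-typeI ¬greatest with path-through a | path-through b
    ... | Pa , isPathPa , a⊆Pa | Pb , isPathPb , b⊆Pb =
      ( meet-trunk partner ⋂⇓-stem , PathsThrough A , (λ _ → proj₁ ∘ unresize)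
      , (Pa , Pb , path∈PathsThrough isPathPa a∈A a⊆Pa , path∈PathsThrough isPathPb b∈A b⊆Pb , Pa≉Pb)
      , ⋂⇓≐⋂paths) , ¬greatest
      where
      Pa≉Pb : ¬ SameSet Pa Pb
      Pa≉Pb (_ , Pb⊆Pa) = incomparable⇒¬⇓-in-chain (antichain a∈A b∈A (b≉a ∘ ≈ˣ-sym))
                            (proj₁ isPathPa) a⊆Pa (Pb⊆Pa ∘ b⊆Pb)

    ⋂⇓-infimum : ∃ λ w → X.IsInfimum A w
    ⋂⇓-infimum with node-of-stem ⋂⇓-stem ⋂⇓-typeI
    ... | w , w≐⋂⇓ = w , meet-infimum w≐⋂⇓

  ≈-member-infimum : ∀ {A : Pred Node (suc ℓ)} {a} → a ∈ A → (∀ {n} → n ∈ A → n ≈ˣ a) → X.IsInfimum A a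
  ≈-member-infimum a∈A ≈a = (λ n∈A → inj₂ (≈ˣ-sym (≈a n∈A))) , (λ _ v-lb → v-lb a∈A)

  antichainComplete : X.AntichainComplete (suc ℓ)
  antichainComplete A antichain (a , a∈A) (z , z-lb) with em₁ {∃ λ b → b ∈ A × ¬ (b ≈ˣ a)}
  ... | yes (b , b∈A , b≉a) = ⋂⇓-infimum antichain a∈A b∈A b≉a z-lb
  ... | no all≈a = a , ≈-member-infimum a∈A ≈a
    where
    ≈a : ∀ {n} → n ∈ A → n ≈ˣ a
    ≈a {n} n∈A with em₁ {n ≈ˣ a}
    ... | yes n≈a = n≈a
    ... | no n≉a = ⊥-elim (all≈a (n , n∈A , n≉a))

mainTheorem13 : ∀ {ℓ : Level} → ExcludedMiddle ℓ → ExcludedMiddle (suc ℓ) → HausdorffMaximal ℓ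
    → (T : Set ℓ) (_<_ : Rel T ℓ) → TreeNotions.IsTree {X = T} _≡_ _<_
    → (TreeNotions.IsTree (TrunkNotions.Extension._≈ˣ_ T _<_ (TrunkNotions.𝒯I T _<_)) (TrunkNotions.Extension._<ˣ_ T _<_ (TrunkNotions.𝒯I T _<_))
       × TreeNotions.AntichainComplete (TrunkNotions.Extension._≈ˣ_ T _<_ (TrunkNotions.𝒯I T _<_)) (TrunkNotions.Extension._<ˣ_ T _<_ (TrunkNotions.𝒯I T _<_)) (suc ℓ)
       × TrunkNotions.Extension.ContainsT T _<_ (TrunkNotions.𝒯I T _<_))
    × (TreeNotions.IsTree (TrunkNotions.Extension._≈ˣ_ T _<_ (TrunkNotions.𝒯fin T _<_)) (TrunkNotions.Extension._<ˣ_ T _<_ (TrunkNotions.𝒯fin T _<_))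
       × TreeNotions.BranchingComplete (TrunkNotions.Extension._≈ˣ_ T _<_ (TrunkNotions.𝒯fin T _<_)) (TrunkNotions.Extension._<ˣ_ T _<_ (TrunkNotions.𝒯fin T _<_))
       × TrunkNotions.Extension.ContainsT T _<_ (TrunkNotions.𝒯fin T _<_))
mainTheorem13 em em₁ hm T _<_ tree =
    (I.<ˣ-isTree , I.antichainComplete , I.containsT)
  , (F.<ˣ-isTree , F.branchingComplete , F.containsT)
  where
  module I = TypeI em em₁ hm T _<_ tree
  module F = FinitelyGenerated em hm T _<_ tree
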